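{- Let $G=(L\cup R,F)$ be a regular bipartite graph with $L=R=[n]$ and edge set $F=\{e_1,\dots,e_\ell\}\subseteq[n]\times[n]$, and let $\mathtt{A}_G\in\mathrm{T}(n\times n\times\ell,\mathbb{F})$ be the 3-way array whose $i$th frontal slice is $E_{e_i}$. Then $G$ is asymmetric if and only if $\mathrm{Aut}(\mathtt{A}_G)\subseteq\mathrm{diag}(n,\mathbb{F})\times\mathrm{diag}(n,\mathbb{F})\times\mathrm{diag}(\ell,\mathbb{F})$. Furthermore, in this case every invertible diagonal $n\times n$ matrix occurs as the first coordinate of some element of $\mathrm{Aut}(\mathtt{A}_G)$.
   Context: $E_{a,b}\in\mathrm{M}(n,\mathbb{F})$ is the matrix with $1$ in position $(a,b)$ and $0$ elsewhere. $\mathrm{Aut}(\mathtt{A})$ is the set of $(R,S,T)\in\mathrm{GL}(n)\times\mathrm{GL}(n)\times\mathrm{GL}(\ell)$ with $(R,S,T)\cdot\mathtt{A}=\mathtt{A}$, where $(R,S,T)$ acts by $a'_{i,j,k}=\sum r_{i,i'}s_{j,j'}t_{k,k'}a_{i',j',k'}$. $\mathrm{diag}(n,\mathbb{F})$ is the group of invertible diagonal matrices. $G$ is regular if all vertices have the same degree; an automorphism of $G$ is a pair $(\sigma,\tau)\in S_n\times S_n$ with $(i,j)\in F\iff(\sigma(i),\tau(j))\in F$, and $G$ is asymmetric if its only automorphism is trivial. -}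

module Defs where

open import Level using (Level; _⊔_) renaming (suc to lsuc)
open import Algebra.Bundles using (CommutativeRing)
open import Data.Nat.Base as ℕ using (ℕ; zero; suc; _+_)
open import Data.Fin.Base using (Fin; zero; suc)
open import Data.Fin.Properties using (_≟_)
open import Data.Fin.Permutation using (Permutation′; _⟨$⟩ʳ_)
open import Data.Product using (Σ; ∃; ∃-syntax; _×_; _,_; proj₁; proj₂)
open import Data.Product.Properties using (≡-dec)
open import Relation.Nullary using (¬_; yes; no; Dec)
open import Relation.Binary.PropositionalEquality using (_≡_)
open import Function.Bundles using (_⇔_)
import Algebra.Definitions.RawMonoid as RawMonoidDefs

record Field (c ℓ : Level) : Set (lsuc (c ⊔ ℓ)) where
  field
    commutativeRing : CommutativeRing c ℓ
  open CommutativeRing commutativeRing public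
  field
    0≉1     : ¬ (0# ≈ 1#)
    inverse : ∀ x → ¬ (x ≈ 0#) → ∃[ y ] (x * y ≈ 1#)

-- Bipartite graphs G = (L ∪ R, F) with L = R = [n], given by an
-- enumeration e : Fin ℓ → Fin n × Fin n of the edge set F = {e_1,…,e_ℓ}
-- (distinctness of the e_k is imposed as injectivity in the statement).

Edges : ℕ → ℕ → Set
Edges n ℓ = Fin ℓ → Fin n × Fin n

countFin : ∀ {ℓ} → (Fin ℓ → ℕ) → ℕ
countFin {zero}  f = 0
countFin {suc ℓ} f = f zero + countFin (λ k → f (suc k))

degL : ∀ {n ℓ} → Edges n ℓ → Fin n → ℕ
degL e i = countFin (λ k → indicator (proj₁ (e k) ≟ i))
  where
  indicator : ∀ {P : Set} → Dec P → ℕ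
  indicator (yes _) = 1
  indicator (no  _) = 0

degR : ∀ {n ℓ} → Edges n ℓ → Fin n → ℕ
degR e j = countFin (λ k → indicator (proj₂ (e k) ≟ j))
  where
  indicator : ∀ {P : Set} → Dec P → ℕ
  indicator (yes _) = 1
  indicator (no  _) = 0

Regular : ∀ {n ℓ} → Edges n ℓ → Set
Regular {n} e = ∃[ d ] ((∀ (i : Fin n) → degL e i ≡ d) × (∀ (j : Fin n) → degR e j ≡ d))

HasEdge : ∀ {n ℓ} → Edges n ℓ → Fin n → Fin n → Set
HasEdge {ℓ = ℓ} e i j = ∃[ k ] (e k ≡ (i , j))

IsGraphAut : ∀ {n ℓ} → Edges n ℓ → Permutation′ n → Permutation′ n → Set
IsGraphAut e σ τ = ∀ i j → HasEdge e i j ⇔ HasEdge e (σ ⟨$⟩ʳ i) (τ ⟨$⟩ʳ j)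

Asymmetric : ∀ {n ℓ} → Edges n ℓ → Set
Asymmetric {n} e = ∀ (σ τ : Permutation′ n) → IsGraphAut e σ τ →
                   (∀ i → σ ⟨$⟩ʳ i ≡ i) × (∀ j → τ ⟨$⟩ʳ j ≡ j)

module _ {c ℓ′} (F : Field c ℓ′) where
  open Field F
  open RawMonoidDefs +-rawMonoid using (sum)

  Mat : ℕ → ℕ → Set c
  Mat m k = Fin m → Fin k → Carrier


  infixl 7 _⊗_
  _⊗_ : ∀ {m k p} → Mat m k → Mat k p → Mat m p
  (A ⊗ B) i j = sum (λ r → A i r * B r j)

  I : ∀ {m} → Mat m m
  I i j with i ≟ j
  ... | yes _ = 1#
  ... | no  _ = 0#

  infix 4 _≈M_
  _≈M_ : ∀ {m k} → Mat m k → Mat m k → Set ℓ′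
  A ≈M B = ∀ i j → A i j ≈ B i j

  Invertible : ∀ {m} → Mat m m → Set (c ⊔ ℓ′)
  Invertible A = ∃[ B ] ((A ⊗ B ≈M I) × (B ⊗ A ≈M I))

  IsDiagonal : ∀ {m} → Mat m m → Set (c ⊔ ℓ′)
  IsDiagonal A = Invertible A × (∀ i j → ¬ (i ≡ j) → A i j ≈ 0#)

  Tensor : ℕ → ℕ → ℕ → Set c
  Tensor n m ℓ = Fin n → Fin m → Fin ℓ → Carrier

  act : ∀ {n m ℓ} → Mat n n → Mat m m → Mat ℓ ℓ → Tensor n m ℓ → Tensor n m ℓ
  act R S T A i j k =
    sum (λ i′ → sum (λ j′ → sum (λ k′ → R i i′ * S j j′ * T k k′ * A i′ j′ k′)))

  InAut : ∀ {n m ℓ} → Tensor n m ℓ → Mat n n → Mat m m → Mat ℓ ℓ → Set (c ⊔ ℓ′)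
  InAut A R S T = Invertible R × Invertible S × Invertible T ×
                  (∀ i j k → act R S T A i j k ≈ A i j k)

  arrayOf : ∀ {n ℓ} → Edges n ℓ → Tensor n n ℓ
  arrayOf e i j k with ≡-dec _≟_ _≟_ (e k) (i , j)
  ... | yes _ = 1#
  ... | no  _ = 0#

  AutDiagonal : ∀ {n ℓ} → Edges n ℓ → Set (c ⊔ ℓ′)
  AutDiagonal {n} {ℓ} e = ∀ (R S : Mat n n) (T : Mat ℓ ℓ) → InAut (arrayOf e) R S T →
                          IsDiagonal R × IsDiagonal S × IsDiagonal T

{-# OPTIONS --safe #-}
module Submission where

-- If (R, S, T) ∈ Aut(A_G) then, since T is invertible, R x a · S y b = 0 whenever
-- (a, b) is an edge and (x, y) is not.  Fix a column a of R and a row x with R x a ≠ 0.  The d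
-- columns of S indexed by the neighbours of a are linearly independent, so they are nonzero on
-- at least d rows, and each such row is a neighbour of x; by d-regularity these rows are
-- exactly the neighbours of x.  So all rows x with R x a ≠ 0 have the same neighbourhood, and
-- an asymmetric graph has no such twins: column a of R has a single nonzero entry, in row φ a,
-- and likewise column b of S in row ψ b.  The pair (φ, ψ) maps edges to edges, so it is a graph
-- automorphism, hence the identity; the diagonals of R and S are therefore nonzero, and using
-- twin-freeness once more all off-diagonal entries of R, S and then T vanish.  Conversely an
-- automorphism (σ, τ) permutes the edges by some π, and (P σ, P τ, P π) ∈ Aut(A_G) forces
-- σ = τ = id.  Finally D ∈ diag(n) extends to (D, 1, diag (k ↦ D(a_k, a_k)⁻¹)).
--
-- Equality in the field is not decidable, so zero patterns of matrices are only available under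
-- double negation; this suffices because they are only used to prove negative or decidable facts.

open import Level using (Level)
open import Data.Empty using (⊥-elim)
open import Data.Nat.Base using (ℕ; zero; suc; _≤_; z≤n; s≤s)
import Data.Nat.Properties as ℕ
open import Data.Nat.Properties using (_≤?_; ≤-antisym; ≤-trans; <⇒≱; m≤n⇒m≤1+n)
open import Data.Fin.Base using (Fin; zero; suc; punchIn)
open import Data.Fin.Properties using (_≟_; any?; suc-injective; ∀-cons; punchInᵢ≢i; ¬Fin0)
open import Data.Fin.Subset
  using (Subset; _∈_; _∉_; _⊆_; _─_; _-_; ∣_∣; ⊤; Nonempty; inside; outside; ⁅_⁆)
open import Data.Fin.Subset.Properties
  using ( _∈?_; ∈⊤; x∈⁅x⁆; p─⊥≡p; p─q⊆p; x∈p∧x≢y⇒x∈p-y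
        ; p⊆q⇒∣p∣≤∣q∣; x∈p⇒∣p-x∣<∣p∣; nonempty?; Empty-unique; ∣⊥∣≡0)
open import Data.Fin.Permutation using (Permutation′; _⟨$⟩ʳ_; _⟨$⟩ˡ_; permutation; transpose)
import Data.Fin.Permutation as Perm
open import Data.Vec.Base using ([]; _∷_; tabulate; here; there)
open import Data.Vec.Properties using (lookup⇒[]=; []=⇒lookup; lookup∘tabulate)
open import Data.Product using (Σ; ∃; ∃-syntax; _×_; _,_; proj₁; proj₂; swap; map)
open import Data.Product.Properties using (≡-dec; ×-≡,≡→≡; ×-≡,≡←≡)
open import Function using (_∘_)
open import Function.Definitions using (Injective)
open import Function.Bundles using (_⇔_; mk⇔; Equivalence; Injection)
open import Function.Properties.Inverse using (↔⇒↣)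
open import Function.Construct.Identity using (⇔-id)
open import Function.Construct.Symmetry using (⇔-sym)
open import Relation.Nullary using (¬_; Dec; yes; no; does; contradiction; ¬?; _×-dec_)
open import Relation.Nullary.Decidable using (dec-true; ¬¬-excluded-middle; decidable-stable)
open import Relation.Unary using (Pred; Decidable)
open import Relation.Binary.PropositionalEquality as ≡ using (_≡_; _≢_; refl)

open import Defs

private variable
  m n : ℕ

subset : ∀ {p} {P : Pred (Fin n) p} → Decidable P → Subset n
subset P? = tabulate (does ∘ P?)

module _ {p} {P : Pred (Fin n) p} (P? : Decidable P) where

  ∈-subset⁺ : ∀ {x} → P x → x ∈ subset P?
  ∈-subset⁺ {x} px = lookup⇒[]= x _ (≡.trans (lookup∘tabulate _ x) (dec-true (P? x) px))

  ∈-subset⁻ : ∀ {x} → x ∈ subset P? → P x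
  ∈-subset⁻ {x} x∈ with P? x | ≡.trans (≡.sym (lookup∘tabulate (does ∘ P?) x)) ([]=⇒lookup x∈)
  ... | yes px | _  = px
  ... | no  _  | ()

x∈p─q⇒x∉q : ∀ {p q : Subset n} {x} → x ∈ p ─ q → x ∉ q
x∈p─q⇒x∉q {p = _ ∷ _} {outside ∷ _} here       ()
x∈p─q⇒x∉q {p = _ ∷ _} {inside ∷ _}  ()        here
x∈p─q⇒x∉q {p = _ ∷ _} {_ ∷ _}       (there x∈) (there x∈q) = x∈p─q⇒x∉q x∈ x∈q

x∈p-y⇒x≢y : ∀ {p : Subset n} {x y} → x ∈ p - y → x ≢ y
x∈p-y⇒x≢y x∈ refl = x∈p─q⇒x∉q x∈ (x∈⁅x⁆ _)

∣p∣≡1+∣p-x∣ : ∀ {p : Subset n} {x} → x ∈ p → ∣ p ∣ ≡ suc ∣ p - x ∣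
∣p∣≡1+∣p-x∣ {p = inside ∷ p}  here = ≡.cong (suc ∘ ∣_∣) (≡.sym (p─⊥≡p p))
∣p∣≡1+∣p-x∣ {p = inside ∷ p}  (there x∈p) = ≡.cong suc (∣p∣≡1+∣p-x∣ x∈p)
∣p∣≡1+∣p-x∣ {p = outside ∷ p} (there x∈p) = ∣p∣≡1+∣p-x∣ x∈p

∣p∣≢0⇒Nonempty : ∀ {p : Subset n} → ∣ p ∣ ≢ 0 → Nonempty p
∣p∣≢0⇒Nonempty {n} {p} ∣p∣≢0 with nonempty? p
... | yes p-nonempty = p-nonempty
... | no  p-empty    = contradiction (≡.trans (≡.cong ∣_∣ (Empty-unique p-empty)) (∣⊥∣≡0 n)) ∣p∣≢0

∣p∣≤∣q∣-injection : ∀ (f : Fin m → Fin n) {p : Subset m} {q : Subset n} →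
  (∀ {x} → x ∈ p → f x ∈ q) →
  (∀ {x y} → x ∈ p → y ∈ p → f x ≡ f y → x ≡ y) →
  ∣ p ∣ ≤ ∣ q ∣
∣p∣≤∣q∣-injection f {[]}          _    _   = z≤n
∣p∣≤∣q∣-injection f {outside ∷ p} into inj =
  ∣p∣≤∣q∣-injection (f ∘ suc) (into ∘ there) (λ x∈ y∈ → suc-injective ∘ inj (there x∈) (there y∈))
∣p∣≤∣q∣-injection f {inside ∷ p} {q} into inj = ≤-trans (s≤s ih) (x∈p⇒∣p-x∣<∣p∣ (into here))
  where
  ih : ∣ p ∣ ≤ ∣ q - f zero ∣
  ih = ∣p∣≤∣q∣-injection (f ∘ suc)
    (λ x∈ → x∈p∧x≢y⇒x∈p-y (into (there x∈)) (λ eq → contradiction (inj (there x∈) here eq) λ ()))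
    (λ x∈ y∈ → suc-injective ∘ inj (there x∈) (there y∈))

∣q∣≤∣p∣-surjection : ∀ (f : Fin m → Fin n) {p : Subset m} {q : Subset n} →
  (∀ {y} → y ∈ q → ∃ λ x → x ∈ p × f x ≡ y) →
  ∣ q ∣ ≤ ∣ p ∣
∣q∣≤∣p∣-surjection f {[]} {q} onto = ℕ.≤-reflexive (decidable-stable (∣ q ∣ ℕ.≟ 0) λ ∣q∣≢0 →
  ¬Fin0 (proj₁ (onto (proj₂ (∣p∣≢0⇒Nonempty ∣q∣≢0)))))
∣q∣≤∣p∣-surjection f {outside ∷ p} onto = ∣q∣≤∣p∣-surjection (f ∘ suc) onto′
  where
  onto′ : ∀ {y} → y ∈ _ → ∃ λ x → x ∈ p × f (suc x) ≡ y
  onto′ y∈q with onto y∈q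
  ... | suc x , there x∈p , fx≡y = x , x∈p , fx≡y
∣q∣≤∣p∣-surjection f {inside ∷ p} {q} onto with f zero ∈? q
... | yes f₀∈q =
  ≡.subst (_≤ suc ∣ p ∣) (≡.sym (∣p∣≡1+∣p-x∣ f₀∈q)) (s≤s (∣q∣≤∣p∣-surjection (f ∘ suc) onto′))
  where
  onto′ : ∀ {y} → y ∈ q - f zero → ∃ λ x → x ∈ p × f (suc x) ≡ y
  onto′ y∈ with onto (p─q⊆p q _ y∈)
  ... | zero  , _         , refl = contradiction refl (x∈p-y⇒x≢y y∈)
  ... | suc x , there x∈p , fx≡y = x , x∈p , fx≡y
... | no  f₀∉q = m≤n⇒m≤1+n (∣q∣≤∣p∣-surjection (f ∘ suc) onto′)
  where
  onto′ : ∀ {y} → y ∈ q → ∃ λ x → x ∈ p × f (suc x) ≡ y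
  onto′ y∈q with onto y∈q
  ... | zero  , _         , refl = contradiction y∈q f₀∉q
  ... | suc x , there x∈p , fx≡y = x , x∈p , fx≡y

p⊆q∧∣q∣≤∣p∣⇒q⊆p : ∀ {p q : Subset n} → p ⊆ q → ∣ q ∣ ≤ ∣ p ∣ → q ⊆ p
p⊆q∧∣q∣≤∣p∣⇒q⊆p {p = p} {q} p⊆q ∣q∣≤∣p∣ {y} y∈q with y ∈? p
... | yes y∈p = y∈p
... | no  y∉p =
  contradiction ∣q∣≤∣p∣ (<⇒≱ (≤-trans (s≤s ∣p∣≤∣q-y∣) (x∈p⇒∣p-x∣<∣p∣ y∈q)))
  where
  ∣p∣≤∣q-y∣ : ∣ p ∣ ≤ ∣ q - y ∣
  ∣p∣≤∣q-y∣ = p⊆q⇒∣p∣≤∣q∣ {q = q - y} λ x∈p →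
    x∈p∧x≢y⇒x∈p-y (p⊆q x∈p) (λ { refl → y∉p x∈p })

injective⇒surjective : ∀ {f : Fin n → Fin n} → Injective _≡_ _≡_ f → ∀ y → ∃ λ x → f x ≡ y
injective⇒surjective {f = f} inj y with any? (λ x → f x ≟ y)
... | yes hit = hit
... | no  miss =
  contradiction (∣p∣≤∣q∣-injection f into (λ _ _ → inj)) (<⇒≱ (x∈p⇒∣p-x∣<∣p∣ (∈⊤ {x = y})))
  where
  into : ∀ {x} → x ∈ ⊤ → f x ∈ ⊤ - y
  into {x} _ = x∈p∧x≢y⇒x∈p-y ∈⊤ (λ fx≡y → miss (x , fx≡y))

injective⇒permutation : ∀ {f : Fin n → Fin n} → Injective _≡_ _≡_ f →
  Σ (Permutation′ n) λ π → ∀ i → π ⟨$⟩ʳ i ≡ f i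
injective⇒permutation {f = f} inj =
  permutation f (proj₁ ∘ surj) (proj₂ ∘ surj) (λ x → inj (proj₂ (surj (f x)))) , λ _ → refl
  where
  surj : ∀ y → ∃ λ x → f x ≡ y
  surj = injective⇒surjective inj

¬¬-∀ : ∀ {p} {P : Fin n → Set p} → (∀ i → ¬ ¬ P i) → ¬ ¬ (∀ i → P i)
¬¬-∀ {n = zero}  _ k = k λ ()
¬¬-∀ {n = suc n} h k = h zero λ p₀ → ¬¬-∀ (h ∘ suc) λ ps → k (∀-cons p₀ ps)

¬¬-decidable₂ : ∀ {p} {P : Fin m → Fin n → Set p} → ¬ ¬ (∀ i j → Dec (P i j))
¬¬-decidable₂ = ¬¬-∀ λ _ → ¬¬-∀ λ _ → ¬¬-excluded-middle

module _ {n ℓ : ℕ} (e : Edges n ℓ) where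

  hasEdge? : ∀ i j → Dec (HasEdge e i j)
  hasEdge? i j = any? λ k → ≡-dec _≟_ _≟_ (e k) (i , j)

  neighbours : Fin n → Subset n
  neighbours x = subset (hasEdge? x)

  ∈-neighbours⁺ : ∀ {x y} → HasEdge e x y → y ∈ neighbours x
  ∈-neighbours⁺ {x} = ∈-subset⁺ (hasEdge? x)

  ∈-neighbours⁻ : ∀ {x y} → y ∈ neighbours x → HasEdge e x y
  ∈-neighbours⁻ {x} = ∈-subset⁻ (hasEdge? x)

  edgesAt : Fin n → Subset ℓ
  edgesAt x = subset (λ k → proj₁ (e k) ≟ x)

swapEdges : ∀ {n ℓ} → Edges n ℓ → Edges n ℓ
swapEdges e = swap ∘ e

HasEdge-swap : ∀ {n ℓ} {e : Edges n ℓ} {i j} → HasEdge e i j → HasEdge (swapEdges e) j i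
HasEdge-swap (k , ek≡ij) = k , ≡.cong swap ek≡ij

degL≡∣edgesAt∣ : ∀ {n ℓ} (e : Edges n ℓ) x → degL e x ≡ ∣ edgesAt e x ∣
degL≡∣edgesAt∣ {ℓ = zero}  e x = ≡.refl
degL≡∣edgesAt∣ {ℓ = suc ℓ} e x with proj₁ (e zero) ≟ x
... | yes _ = ≡.cong suc (degL≡∣edgesAt∣ (e ∘ suc) x)
... | no  _ = degL≡∣edgesAt∣ (e ∘ suc) x

degR≡∣edgesAt∣ : ∀ {n ℓ} (e : Edges n ℓ) y → degR e y ≡ ∣ edgesAt (swapEdges e) y ∣
degR≡∣edgesAt∣ {ℓ = zero}  e y = ≡.refl
degR≡∣edgesAt∣ {ℓ = suc ℓ} e y with proj₂ (e zero) ≟ y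
... | yes _ = ≡.cong suc (degR≡∣edgesAt∣ (e ∘ suc) y)
... | no  _ = degR≡∣edgesAt∣ (e ∘ suc) y

module _ {n ℓ : ℕ} {e : Edges n ℓ} (e-injective : Injective _≡_ _≡_ e) where

  ∣edgesAt∣≡∣neighbours∣ : ∀ x → ∣ edgesAt e x ∣ ≡ ∣ neighbours e x ∣
  ∣edgesAt∣≡∣neighbours∣ x = ≤-antisym
    (∣p∣≤∣q∣-injection (proj₂ ∘ e) into injective)
    (∣q∣≤∣p∣-surjection (proj₂ ∘ e) onto)
    where
    source : ∀ {k} → k ∈ edgesAt e x → proj₁ (e k) ≡ x
    source = ∈-subset⁻ (λ k → proj₁ (e k) ≟ x)
    into : ∀ {k} → k ∈ edgesAt e x → proj₂ (e k) ∈ neighbours e x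
    into {k} k∈ = ∈-neighbours⁺ e (k , ×-≡,≡→≡ (source k∈ , ≡.refl))
    injective : ∀ {k k′} → k ∈ edgesAt e x → k′ ∈ edgesAt e x → proj₂ (e k) ≡ proj₂ (e k′) → k ≡ k′
    injective k∈ k′∈ bk≡bk′ =
      e-injective (×-≡,≡→≡ (≡.trans (source k∈) (≡.sym (source k′∈)) , bk≡bk′))
    onto : ∀ {y} → y ∈ neighbours e x → ∃ λ k → k ∈ edgesAt e x × proj₂ (e k) ≡ y
    onto y∈ with k , ek≡xy ← ∈-neighbours⁻ e y∈ with ×-≡,≡←≡ ek≡xy
    ... | ak≡x , bk≡y = k , ∈-subset⁺ (λ k → proj₁ (e k) ≟ x) ak≡x , bk≡y

  swapEdges-injective : Injective _≡_ _≡_ (swapEdges e)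
  swapEdges-injective eq = e-injective (≡.cong swap eq)

⟨$⟩ʳ-injective : ∀ (π : Permutation′ n) → Injective _≡_ _≡_ (π ⟨$⟩ʳ_)
⟨$⟩ʳ-injective π = Injection.injective (↔⇒↣ π)

transpose-twins : ∀ {r} {A : Set} (_∼_ : Fin n → A → Set r) {x x′} → (∀ y → x ∼ y ⇔ x′ ∼ y) →
  ∀ k y → k ∼ y ⇔ (transpose x x′ ⟨$⟩ʳ k) ∼ y
transpose-twins _∼_ {x} {x′} twins k y with k ≟ x
... | yes refl = twins y
... | no  _ with k ≟ x′
...   | yes refl = ⇔-sym (twins y)
...   | no  _    = ⇔-id _

TwinFree : ∀ {n ℓ} → Edges n ℓ → Set
TwinFree e = ∀ {x x′} → (∀ y → HasEdge e x y ⇔ HasEdge e x′ y) → x ≡ x′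

module _ {n ℓ : ℕ} {e : Edges n ℓ} (asymmetric : Asymmetric e) where

  asymmetric⇒twinFree : TwinFree e
  asymmetric⇒twinFree {x} {x′} twins = ≡.trans (≡.sym (proj₁ (asymmetric σ Perm.id aut) x)) σx≡x′
    where
    σ : Permutation′ n
    σ = transpose x x′
    σx≡x′ : σ ⟨$⟩ʳ x ≡ x′
    σx≡x′ rewrite dec-true (x ≟ x) ≡.refl = ≡.refl
    aut : IsGraphAut e σ Perm.id
    aut = transpose-twins (HasEdge e) twins

  asymmetric-swap : Asymmetric (swapEdges e)
  asymmetric-swap σ τ aut = swap (asymmetric τ σ λ i j →
    mk⇔ (HasEdge-swap ∘ Equivalence.to (aut j i) ∘ HasEdge-swap)
        (HasEdge-swap ∘ Equivalence.from (aut j i) ∘ HasEdge-swap))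

module _ {n ℓ : ℕ} {e : Edges n ℓ} (e-injective : Injective _≡_ _≡_ e) (σ τ : Permutation′ n) where

  private
    σ×τ : Fin n × Fin n → Fin n × Fin n
    σ×τ = map (σ ⟨$⟩ʳ_) (τ ⟨$⟩ʳ_)

    σ×τ-injective : Injective _≡_ _≡_ σ×τ
    σ×τ-injective eq with σi≡σi′ , τj≡τj′ ← ×-≡,≡←≡ eq =
      ×-≡,≡→≡ (⟨$⟩ʳ-injective σ σi≡σi′ , ⟨$⟩ʳ-injective τ τj≡τj′)

  edgePermutation : (∀ k → HasEdge e (σ ⟨$⟩ʳ proj₁ (e k)) (τ ⟨$⟩ʳ proj₂ (e k))) →
    Σ (Permutation′ ℓ) λ π → ∀ k → e (π ⟨$⟩ʳ k) ≡ map (σ ⟨$⟩ʳ_) (τ ⟨$⟩ʳ_) (e k)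
  edgePermutation image =
    proj₁ π , λ k → ≡.trans (≡.cong e (proj₂ π k)) (proj₂ (image k))
    where
    π-injective : Injective _≡_ _≡_ (proj₁ ∘ image)
    π-injective {k} {k′} eq = e-injective (σ×τ-injective
      (≡.trans (≡.sym (proj₂ (image k))) (≡.trans (≡.cong e eq) (proj₂ (image k′)))))
    π : Σ (Permutation′ ℓ) λ π → ∀ k → π ⟨$⟩ʳ k ≡ proj₁ (image k)
    π = injective⇒permutation π-injective

  edgePreserving⇒IsGraphAut : (∀ i j → HasEdge e i j → HasEdge e (σ ⟨$⟩ʳ i) (τ ⟨$⟩ʳ j)) →
                              IsGraphAut e σ τ
  edgePreserving⇒IsGraphAut preserve i j
    with π , eπ≡ ← edgePermutation (λ k → preserve _ _ (k , ≡.refl)) = mk⇔ (preserve i j) reflect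
    where
    reflect : HasEdge e (σ ⟨$⟩ʳ i) (τ ⟨$⟩ʳ j) → HasEdge e i j
    reflect (k′ , ek′≡) = π ⟨$⟩ˡ k′ , σ×τ-injective
      (≡.trans (≡.sym (eπ≡ (π ⟨$⟩ˡ k′))) (≡.trans (≡.cong e (Perm.inverseʳ π)) ek′≡))

module _ {n ℓ : ℕ} {e : Edges n ℓ} (e-injective : Injective _≡_ _≡_ e) {d} (regular : ∀ x → degL e x ≡ d) where

  ∣neighbours∣≡d : ∀ x → ∣ neighbours e x ∣ ≡ d
  ∣neighbours∣≡d x = begin
    ∣ neighbours e x ∣ ≡⟨ ∣edgesAt∣≡∣neighbours∣ e-injective x ⟨
    ∣ edgesAt e x ∣    ≡⟨ degL≡∣edgesAt∣ e x ⟨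
    degL e x           ≡⟨ regular x ⟩
    d                  ∎
    where open ≡.≡-Reasoning

  neighbours-⊆⇒≡ : TwinFree e → ∀ {x x′} → neighbours e x ⊆ neighbours e x′ → x ≡ x′
  neighbours-⊆⇒≡ twinFree {x} {x′} N⊆N′ =
    twinFree λ y → mk⇔ (∈-neighbours⁻ e ∘ N⊆N′ ∘ ∈-neighbours⁺ e)
                       (∈-neighbours⁻ e ∘ N′⊆N ∘ ∈-neighbours⁺ e)
    where
    N′⊆N : neighbours e x′ ⊆ neighbours e x
    N′⊆N = p⊆q∧∣q∣≤∣p∣⇒q⊆p N⊆N′
      (ℕ.≤-reflexive (≡.trans (∣neighbours∣≡d x′) (≡.sym (∣neighbours∣≡d x))))

module _ {c ℓ′} (F : Field c ℓ′) where

  open Field F hiding (zero; _-_) renaming (refl to ≈-refl)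
  open import Algebra.Properties.Semiring.Sum semiring
    using ( sum; sum-cong-≋; sum-replicate-zero; sum-remove; ∑-comm; ∑-distrib-+
          ; *-distribˡ-sum; *-distribʳ-sum)
  open import Algebra.Properties.Ring ring using (-‿distribʳ-*)
  open import Relation.Binary.Reasoning.Setoid setoid

  1≉0 : 1# ≉ 0#
  1≉0 = 0≉1 ∘ sym

  x*y≈0⇒x≈0 : ∀ {x y} → x * y ≈ 0# → y ≉ 0# → x ≈ 0#
  x*y≈0⇒x≈0 {x} {y} xy≈0 y≉0 with y⁻¹ , yy⁻¹≈1 ← inverse y y≉0 = begin
    x             ≈⟨ *-identityʳ x ⟨
    x * 1#        ≈⟨ *-congˡ yy⁻¹≈1 ⟨
    x * (y * y⁻¹) ≈⟨ *-assoc x y y⁻¹ ⟨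
    x * y * y⁻¹   ≈⟨ *-congʳ xy≈0 ⟩
    0# * y⁻¹      ≈⟨ zeroˡ y⁻¹ ⟩
    0#            ∎

  x*y≉0 : ∀ {x y} → x ≉ 0# → y ≉ 0# → x * y ≉ 0#
  x*y≉0 x≉0 y≉0 xy≈0 = x≉0 (x*y≈0⇒x≈0 xy≈0 y≉0)

  sum-≈0 : ∀ {n} {f : Fin n → Carrier} → (∀ i → f i ≈ 0#) → sum f ≈ 0#
  sum-≈0 {n} f≈0 = trans (sum-cong-≋ f≈0) (sum-replicate-zero n)

  sum-single : ∀ {n} {f : Fin n → Carrier} i → (∀ j → j ≢ i → f j ≈ 0#) → sum f ≈ f i
  sum-single {suc _} {f} i others = begin
    sum f                     ≈⟨ sum-remove f ⟩
    f i + sum (f ∘ punchIn i) ≈⟨ +-congˡ (sum-≈0 λ j → others (punchIn i j) (punchInᵢ≢i i j)) ⟩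
    f i + 0#                  ≈⟨ +-identityʳ (f i) ⟩
    f i                       ∎

  I-≡ : ∀ {m} {i j : Fin m} → i ≡ j → I F i j ≈ 1#
  I-≡ {i = i} refl with i ≟ i
  ... | yes _   = ≈-refl
  ... | no  i≢i = contradiction ≡.refl i≢i

  I-refl : ∀ {m} (i : Fin m) → I F i i ≈ 1#
  I-refl i = I-≡ {i = i} ≡.refl

  I-≢ : ∀ {m} {i j : Fin m} → i ≢ j → I F i j ≈ 0#
  I-≢ {i = i} {j} i≢j with i ≟ j
  ... | yes i≡j = contradiction i≡j i≢j
  ... | no  _   = ≈-refl

  δ-sum : ∀ {m} (i : Fin m) (f : Fin m → Carrier) → sum (λ j → I F i j * f j) ≈ f i
  δ-sum i f = begin
    sum (λ j → I F i j * f j) ≈⟨ sum-single i (λ j j≢i → trans (*-congʳ (I-≢ (j≢i ∘ ≡.sym))) (zeroˡ _)) ⟩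
    I F i i * f i             ≈⟨ *-congʳ (I-refl i) ⟩
    1# * f i                  ≈⟨ *-identityˡ (f i) ⟩
    f i                       ∎

  sum-assoc : ∀ {m n p} (U : Mat F m n) (T : Mat F n p) (g : Fin p → Carrier) i →
    sum (λ k → U i k * sum (λ j → T k j * g j)) ≈ sum (λ j → (_⊗_ F U T) i j * g j)
  sum-assoc U T g i = begin
    sum (λ k → U i k * sum (λ j → T k j * g j))
      ≈⟨ sum-cong-≋ (λ k → *-distribˡ-sum (U i k) (λ j → T k j * g j)) ⟩
    sum (λ k → sum (λ j → U i k * (T k j * g j)))
      ≈⟨ sum-cong-≋ (λ k → sum-cong-≋ λ j → *-assoc (U i k) (T k j) (g j)) ⟨
    sum (λ k → sum (λ j → U i k * T k j * g j))
      ≈⟨ ∑-comm (λ k j → U i k * T k j * g j) ⟩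
    sum (λ j → sum (λ k → U i k * T k j * g j))
      ≈⟨ sum-cong-≋ (λ j → *-distribʳ-sum (g j) (λ k → U i k * T k j)) ⟨
    sum (λ j → (_⊗_ F U T) i j * g j)
      ∎

  invertible⇒trivialKernel : ∀ {m} {T : Mat F m m} {g : Fin m → Carrier} → Invertible F T →
    (∀ k → sum (λ j → T k j * g j) ≈ 0#) → ∀ j → g j ≈ 0#
  invertible⇒trivialKernel {T = T} {g} (U , _ , UT≈I) Tg≈0 j = begin
    g j                                          ≈⟨ δ-sum j g ⟨
    sum (λ l → I F j l * g l)                    ≈⟨ sum-cong-≋ (λ l → *-congʳ (UT≈I j l)) ⟨
    sum (λ l → (_⊗_ F U T) j l * g l)            ≈⟨ sum-assoc U T g j ⟨
    sum (λ k → U j k * sum (λ l → T k l * g l))  ≈⟨ sum-≈0 (λ k → trans (*-congˡ (Tg≈0 k)) (zeroʳ _)) ⟩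
    0#                                           ∎

  invertible⇒column≉0 : ∀ {m} {R : Mat F m m} → Invertible F R → ∀ a → ¬ (∀ x → R x a ≈ 0#)
  invertible⇒column≉0 {R = R} (B , _ , BR≈I) a column≈0 = 1≉0 (begin
    1#                         ≈⟨ I-refl a ⟨
    I F a a                    ≈⟨ BR≈I a a ⟨
    sum (λ x → B a x * R x a)  ≈⟨ sum-≈0 (λ x → trans (*-congˡ (column≈0 x)) (zeroʳ (B a x))) ⟩
    0#                         ∎)

  SupportedAt : ∀ {m n} → Mat F m n → Fin m → Fin n → Set ℓ′
  SupportedAt R x a = ∀ y → y ≢ x → R y a ≈ 0#

  supportedAt-injective : ∀ {m} {R : Mat F m m} {x a a′} → Invertible F R →
    SupportedAt R x a → SupportedAt R x a′ → a ≡ a′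
  supportedAt-injective {R = R} {x} {a} {a′} (B , _ , BR≈I) sa sa′ with a ≟ a′
  ... | yes a≡a′ = a≡a′
  ... | no  a≢a′ = ⊥-elim (1≉0 (begin
    1#            ≈⟨ I-refl a ⟨
    I F a a       ≈⟨ BR-at sa a ⟨
    B a x * R x a ≈⟨ *-congʳ (x*y≈0⇒x≈0 (trans (BR-at sa′ a) (I-≢ a≢a′)) Rxa′≉0) ⟩
    0# * R x a    ≈⟨ zeroˡ (R x a) ⟩
    0#            ∎))
    where
    BR-at : ∀ {b} → SupportedAt R x b → ∀ i → B i x * R x b ≈ I F i b
    BR-at {b} s i =
      trans (sym (sum-single x λ y y≢x → trans (*-congˡ (s y y≢x)) (zeroʳ (B i y)))) (BR≈I i b)
    Rxa′≉0 : R x a′ ≉ 0#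
    Rxa′≉0 Rxa′≈0 =
      1≉0 (trans (sym (trans (BR-at sa′ a′) (I-refl a′))) (trans (*-congˡ Rxa′≈0) (zeroʳ _)))

  -- Y′ subtracts from each column j the multiple of column i₀ that clears row r₀.
  module PivotElimination {m n} (Y : Mat F n m) {r₀ i₀} (pivot : Y r₀ i₀ ≉ 0#) where

    private
      y⁻¹ : Carrier
      y⁻¹ = proj₁ (inverse (Y r₀ i₀) pivot)
      yy⁻¹≈1 : Y r₀ i₀ * y⁻¹ ≈ 1#
      yy⁻¹≈1 = proj₂ (inverse (Y r₀ i₀) pivot)

    Y′ : Mat F n m
    Y′ r j = Y r j + Y r i₀ * - (y⁻¹ * Y r₀ j)

    Y′-pivotRow≈0 : ∀ j → Y′ r₀ j ≈ 0#
    Y′-pivotRow≈0 j = begin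
      Y r₀ j + Y r₀ i₀ * - (y⁻¹ * Y r₀ j)   ≈⟨ +-congˡ (-‿distribʳ-* _ _) ⟨
      Y r₀ j + - (Y r₀ i₀ * (y⁻¹ * Y r₀ j)) ≈⟨ +-congˡ (-‿cong (*-assoc _ _ _)) ⟨
      Y r₀ j + - (Y r₀ i₀ * y⁻¹ * Y r₀ j)   ≈⟨ +-congˡ (-‿cong (*-congʳ yy⁻¹≈1)) ⟩
      Y r₀ j + - (1# * Y r₀ j)              ≈⟨ +-congˡ (-‿cong (*-identityˡ (Y r₀ j))) ⟩
      Y r₀ j + - Y r₀ j                     ≈⟨ -‿inverseʳ (Y r₀ j) ⟩
      0#                                    ∎

    Y′-≈0 : ∀ {r j} → Y r j ≈ 0# → Y r i₀ ≈ 0# → Y′ r j ≈ 0#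
    Y′-≈0 {r} {j} Yrj≈0 Yri₀≈0 = begin
      Y r j + Y r i₀ * - (y⁻¹ * Y r₀ j) ≈⟨ +-cong Yrj≈0 (trans (*-congʳ Yri₀≈0) (zeroˡ _)) ⟩
      0# + 0#                           ≈⟨ +-identityˡ 0# ⟩
      0#                                ∎

    X⊗Y′ : ∀ (X : Mat F m n) i j → (_⊗_ F X Y) i i₀ ≈ 0# → (_⊗_ F X Y′) i j ≈ (_⊗_ F X Y) i j
    X⊗Y′ X i j XYii₀≈0 = begin
      sum (λ r → X i r * (Y r j + Y r i₀ * d))
        ≈⟨ sum-cong-≋ (λ r → distribˡ (X i r) (Y r j) (Y r i₀ * d)) ⟩
      sum (λ r → X i r * Y r j + X i r * (Y r i₀ * d))
        ≈⟨ ∑-distrib-+ (λ r → X i r * Y r j) (λ r → X i r * (Y r i₀ * d)) ⟩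
      XY i j + sum (λ r → X i r * (Y r i₀ * d))
        ≈⟨ +-congˡ (sum-cong-≋ λ r → *-assoc (X i r) (Y r i₀) d) ⟨
      XY i j + sum (λ r → X i r * Y r i₀ * d)
        ≈⟨ +-congˡ (*-distribʳ-sum d (λ r → X i r * Y r i₀)) ⟨
      XY i j + XY i i₀ * d
        ≈⟨ +-congˡ (trans (*-congʳ XYii₀≈0) (zeroˡ d)) ⟩
      XY i j + 0#
        ≈⟨ +-identityʳ (XY i j) ⟩
      XY i j
        ∎
      where
      d : Carrier
      d = - (y⁻¹ * Y r₀ j)
      XY : Mat F m m
      XY = _⊗_ F X Y

  rank-bound : ∀ {m n} (X : Mat F m n) (Y : Mat F n m) {Z : Subset m} {W : Subset n} →
    (∀ {i j} → i ∈ Z → j ∈ Z → (_⊗_ F X Y) i j ≈ I F i j) →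
    (∀ {r j} → r ∉ W → j ∈ Z → Y r j ≈ 0#) →
    ∣ Z ∣ ≤ ∣ W ∣
  rank-bound {m} {n} X Y = bound ≡.refl
    where
    bound : ∀ {k} {Y : Mat F n m} {Z : Subset m} {W : Subset n} → ∣ Z ∣ ≡ k →
      (∀ {i j} → i ∈ Z → j ∈ Z → (_⊗_ F X Y) i j ≈ I F i j) →
      (∀ {r j} → r ∉ W → j ∈ Z → Y r j ≈ 0#) →
      k ≤ ∣ W ∣
    bound {zero}  _ _ _ = z≤n
    bound {suc k} {Y} {Z} {W} ∣Z∣≡1+k XY≈I Y≈0
      with i₀ , i₀∈Z ← ∣p∣≢0⇒Nonempty {p = Z} (ℕ.1+n≢0 ∘ ≡.trans (≡.sym ∣Z∣≡1+k))
      = decidable-stable (suc k ≤? ∣ W ∣) λ k≰∣W∣ →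
          ¬¬-decidable₂ λ Y≈0? → k≰∣W∣ (withPivot Y≈0?)
      where
      -- Eliminating at a pivot Y r₀ i₀ ≉ 0 removes i₀ from Z and r₀ from W.
      eliminate : ∀ {r₀} → r₀ ∈ W → (pivot : Y r₀ i₀ ≉ 0#) → k ≤ ∣ W - r₀ ∣
      eliminate {r₀} r₀∈W pivot =
        bound {Y = Y′} (ℕ.suc-injective (≡.trans (≡.sym (∣p∣≡1+∣p-x∣ i₀∈Z)) ∣Z∣≡1+k)) XY′≈I Y′≈0
        where
        open PivotElimination Y pivot
        ⊆Z : Z - i₀ ⊆ Z
        ⊆Z = p─q⊆p Z ⁅ i₀ ⁆
        XY′≈I : ∀ {i j} → i ∈ Z - i₀ → j ∈ Z - i₀ → (_⊗_ F X Y′) i j ≈ I F i j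
        XY′≈I i∈ j∈ = trans (X⊗Y′ X _ _ (trans (XY≈I (⊆Z i∈) i₀∈Z) (I-≢ (x∈p-y⇒x≢y i∈))))
                            (XY≈I (⊆Z i∈) (⊆Z j∈))
        Y′≈0 : ∀ {r j} → r ∉ W - r₀ → j ∈ Z - i₀ → Y′ r j ≈ 0#
        Y′≈0 {r} {j} r∉ j∈ with r ≟ r₀
        ... | yes refl = Y′-pivotRow≈0 j
        ... | no  r≢r₀ = Y′-≈0 (Y≈0 r∉W (⊆Z j∈)) (Y≈0 r∉W i₀∈Z)
          where
          r∉W : r ∉ W
          r∉W r∈W = r∉ (x∈p∧x≢y⇒x∈p-y r∈W r≢r₀)
      withPivot : (∀ r j → Dec (Y r j ≈ 0#)) → suc k ≤ ∣ W ∣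
      withPivot Y≈0? with any? (λ r → r ∈? W ×-dec ¬? (Y≈0? r i₀))
      ... | yes (r₀ , r₀∈W , pivot) = ≤-trans (s≤s (eliminate r₀∈W pivot)) (x∈p⇒∣p-x∣<∣p∣ r₀∈W)
      ... | no  noPivot = ⊥-elim (1≉0 (begin
        1#                          ≈⟨ I-refl i₀ ⟨
        I F i₀ i₀                   ≈⟨ XY≈I i₀∈Z i₀∈Z ⟨
        sum (λ r → X i₀ r * Y r i₀) ≈⟨ sum-≈0 (λ r → trans (*-congˡ (column≈0 r)) (zeroʳ (X i₀ r))) ⟩
        0#                          ∎))
        where
        column≈0 : ∀ r → Y r i₀ ≈ 0#
        column≈0 r with r ∈? W | Y≈0? r i₀
        ... | _         | yes Yri₀≈0 = Yri₀≈0
        ... | yes r∈W   | no  Yri₀≉0 = contradiction (r , r∈W , Yri₀≉0) noPivot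
        ... | no  r∉W   | no  _      = Y≈0 r∉W i₀∈Z

  module _ {n ℓ} (e : Edges n ℓ) where

    arrayOf-≡ : ∀ {i j k} → e k ≡ (i , j) → arrayOf F e i j k ≈ 1#
    arrayOf-≡ {i} {j} {k} ek≡ij with ≡-dec _≟_ _≟_ (e k) (i , j)
    ... | yes _     = ≈-refl
    ... | no  ek≢ij = contradiction ek≡ij ek≢ij

    arrayOf-≢ : ∀ {i j k} → e k ≢ (i , j) → arrayOf F e i j k ≈ 0#
    arrayOf-≢ {i} {j} {k} ek≢ij with ≡-dec _≟_ _≟_ (e k) (i , j)
    ... | yes ek≡ij = contradiction ek≡ij ek≢ij
    ... | no  _     = ≈-refl

    act-arrayOf : ∀ (R S : Mat F n n) (T : Mat F ℓ ℓ) i j k →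
      act F R S T (arrayOf F e) i j k ≈ sum (λ k′ → T k k′ * (R i (proj₁ (e k′)) * S j (proj₂ (e k′))))
    act-arrayOf R S T i j k = begin
      sum (λ i′ → sum (λ j′ → sum (λ k′ → term i′ j′ k′)))
        ≈⟨ sum-cong-≋ (λ i′ → ∑-comm (term i′)) ⟩
      sum (λ i′ → sum (λ k′ → sum (λ j′ → term i′ j′ k′)))
        ≈⟨ ∑-comm (λ i′ k′ → sum (λ j′ → term i′ j′ k′)) ⟩
      sum (λ k′ → sum (λ i′ → sum (λ j′ → term i′ j′ k′)))
        ≈⟨ sum-cong-≋ edgeTerm ⟩
      sum (λ k′ → T k k′ * (R i (proj₁ (e k′)) * S j (proj₂ (e k′))))
        ∎
      where
      term : Fin n → Fin n → Fin ℓ → Carrier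
      term i′ j′ k′ = R i i′ * S j j′ * T k k′ * arrayOf F e i′ j′ k′
      term≈0 : ∀ {i′ j′ k′} → e k′ ≢ (i′ , j′) → term i′ j′ k′ ≈ 0#
      term≈0 ek′≢ = trans (*-congˡ (arrayOf-≢ ek′≢)) (zeroʳ _)
      edgeTerm : ∀ k′ → sum (λ i′ → sum (λ j′ → term i′ j′ k′))
                        ≈ T k k′ * (R i (proj₁ (e k′)) * S j (proj₂ (e k′)))
      edgeTerm k′ = begin
        sum (λ i′ → sum (λ j′ → term i′ j′ k′))
          ≈⟨ sum-single a (λ i′ i′≢a → sum-≈0 {f = λ j′ → term i′ j′ k′} λ j′ →
               term≈0 λ ek′≡ → i′≢a (≡.sym (≡.cong proj₁ ek′≡))) ⟩
        sum (λ j′ → term a j′ k′)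
          ≈⟨ sum-single b (λ j′ j′≢b → term≈0 λ ek′≡ → j′≢b (≡.sym (≡.cong proj₂ ek′≡))) ⟩
        R i a * S j b * T k k′ * arrayOf F e a b k′ ≈⟨ *-congˡ (arrayOf-≡ ≡.refl) ⟩
        R i a * S j b * T k k′ * 1#                 ≈⟨ *-identityʳ _ ⟩
        R i a * S j b * T k k′                      ≈⟨ *-comm _ _ ⟩
        T k k′ * (R i a * S j b)                    ∎
        where
        a b : Fin n
        a = proj₁ (e k′)
        b = proj₂ (e k′)

  RespectsNonEdges : ∀ {n ℓ} → Edges n ℓ → Mat F n n → Mat F n n → Set ℓ′
  RespectsNonEdges e R S = ∀ {a b x y} → HasEdge e a b → ¬ HasEdge e x y → R x a * S y b ≈ 0#

  inAut⇒respectsNonEdges : ∀ {n ℓ} {e : Edges n ℓ} {R S T} →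
    InAut F (arrayOf F e) R S T → RespectsNonEdges e R S
  inAut⇒respectsNonEdges {e = e} {R} {S} {T} (_ , _ , T-invertible , fixes) {x = x} {y} (k , ek≡ab) x≁y =
    ≡.subst (λ p → R x (proj₁ p) * S y (proj₂ p) ≈ 0#) ek≡ab (invertible⇒trivialKernel T-invertible Tg≈0 k)
    where
    Tg≈0 : ∀ k → sum (λ k′ → T k k′ * (R x (proj₁ (e k′)) * S y (proj₂ (e k′)))) ≈ 0#
    Tg≈0 k = begin
      sum (λ k′ → T k k′ * (R x (proj₁ (e k′)) * S y (proj₂ (e k′)))) ≈⟨ act-arrayOf e R S T x y k ⟨
      act F R S T (arrayOf F e) x y k                                ≈⟨ fixes x y k ⟩
      arrayOf F e x y k                                              ≈⟨ arrayOf-≢ e (x≁y ∘ (k ,_)) ⟩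
      0#                                                             ∎

  respectsNonEdges⇒swap : ∀ {n ℓ} {e : Edges n ℓ} {R S} →
    RespectsNonEdges e R S → RespectsNonEdges (swapEdges e) S R
  respectsNonEdges⇒swap respects b∼a y≁x =
    trans (*-comm _ _) (respects (HasEdge-swap b∼a) (y≁x ∘ HasEdge-swap))

  OffDiagonal≈0 : ∀ {m} → Mat F m m → Set ℓ′
  OffDiagonal≈0 M = ∀ i j → i ≢ j → M i j ≈ 0#

  module _ {n ℓ} {e : Edges n ℓ} (e-injective : Injective _≡_ _≡_ e) {d} (regular : ∀ x → degL e x ≡ d)
           (twinFree : TwinFree e) where

    respectsNonEdges⇒offDiagonal≈0 : ∀ {R S} → RespectsNonEdges e R S → (∀ b → S b b ≉ 0#) → OffDiagonal≈0 R
    respectsNonEdges⇒offDiagonal≈0 respects S-diagonal≉0 x a x≢a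
      with any? (λ y → hasEdge? e a y ×-dec ¬? (hasEdge? e x y))
    ... | yes (y , a∼y , x≁y) = x*y≈0⇒x≈0 (respects a∼y x≁y) (S-diagonal≉0 y)
    ... | no  none = contradiction (≡.sym (neighbours-⊆⇒≡ e-injective regular twinFree N⊆N)) x≢a
      where
      N⊆N : neighbours e a ⊆ neighbours e x
      N⊆N {y} y∈ with hasEdge? e x y
      ... | yes x∼y = ∈-neighbours⁺ e x∼y
      ... | no  x≁y = contradiction (y , ∈-neighbours⁻ e y∈ , x≁y) none

    module Monomial {R S : Mat F n n} (R-invertible : Invertible F R) (S-invertible : Invertible F S)
                    (respects : RespectsNonEdges e R S)
                    (R≈0? : ∀ x a → Dec (R x a ≈ 0#)) (S≈0? : ∀ y b → Dec (S y b ≈ 0#)) where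

      rowSupport? : ∀ a y → Dec (∃ λ b → HasEdge e a b × S y b ≉ 0#)
      rowSupport? a y = any? (λ b → hasEdge? e a b ×-dec ¬? (S≈0? y b))

      rowSupport : Fin n → Subset n
      rowSupport a = subset (rowSupport? a)

      ∣neighbours∣≤∣rowSupport∣ : ∀ a → ∣ neighbours e a ∣ ≤ ∣ rowSupport a ∣
      ∣neighbours∣≤∣rowSupport∣ a =
        rank-bound (proj₁ S-invertible) S (λ _ _ → proj₂ (proj₂ S-invertible) _ _) S≈0
        where
        S≈0 : ∀ {r j} → r ∉ rowSupport a → j ∈ neighbours e a → S r j ≈ 0#
        S≈0 {r} {j} r∉ j∈ with S≈0? r j
        ... | yes Srj≈0 = Srj≈0
        ... | no  Srj≉0 = contradiction (∈-subset⁺ (rowSupport? a) (j , ∈-neighbours⁻ e j∈ , Srj≉0)) r∉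

      rowSupport⊆neighbours : ∀ {x a} → R x a ≉ 0# → rowSupport a ⊆ neighbours e x
      rowSupport⊆neighbours {x} {a} Rxa≉0 {y} y∈ with hasEdge? e x y | ∈-subset⁻ (rowSupport? a) y∈
      ... | yes x∼y | _               = ∈-neighbours⁺ e x∼y
      ... | no  x≁y | b , a∼b , Syb≉0 = contradiction (respects a∼b x≁y) (x*y≉0 Rxa≉0 Syb≉0)

      -- Every row x with R x a ≉ 0 has the neighbourhood rowSupport a.
      nonzero-unique : ∀ {x x′ a} → R x a ≉ 0# → R x′ a ≉ 0# → x ≡ x′
      nonzero-unique {x} {x′} {a} Rxa≉0 Rx′a≉0 =
        neighbours-⊆⇒≡ e-injective regular twinFree (rowSupport⊆neighbours Rx′a≉0 ∘ N⊆rowSupport)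
        where
        ∣N∣≤∣rowSupport∣ : ∣ neighbours e x ∣ ≤ ∣ rowSupport a ∣
        ∣N∣≤∣rowSupport∣ = ≡.subst (_≤ ∣ rowSupport a ∣)
          (≡.trans (∣neighbours∣≡d e-injective regular a) (≡.sym (∣neighbours∣≡d e-injective regular x)))
          (∣neighbours∣≤∣rowSupport∣ a)
        N⊆rowSupport : neighbours e x ⊆ rowSupport a
        N⊆rowSupport = p⊆q∧∣q∣≤∣p∣⇒q⊆p (rowSupport⊆neighbours Rxa≉0) ∣N∣≤∣rowSupport∣

      nonzeroRow : ∀ a → ∃ λ x → R x a ≉ 0#
      nonzeroRow a with any? (λ x → ¬? (R≈0? x a))
      ... | yes found  = found
      ... | no  none   = ⊥-elim (invertible⇒column≉0 R-invertible a λ x →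
                           decidable-stable (R≈0? x a) λ Rxa≉0 → none (x , Rxa≉0))

      φ : Fin n → Fin n
      φ a = proj₁ (nonzeroRow a)

      R[φa,a]≉0 : ∀ a → R (φ a) a ≉ 0#
      R[φa,a]≉0 a = proj₂ (nonzeroRow a)

      supportedAt-φ : ∀ a → SupportedAt R (φ a) a
      supportedAt-φ a y y≢φa with R≈0? y a
      ... | yes Rya≈0 = Rya≈0
      ... | no  Rya≉0 = contradiction (nonzero-unique Rya≉0 (R[φa,a]≉0 a)) y≢φa

      φ-injective : Injective _≡_ _≡_ φ
      φ-injective {a} {a′} φa≡φa′ =
        supportedAt-injective R-invertible (supportedAt-φ a)
          (≡.subst (λ x → SupportedAt R x a′) (≡.sym φa≡φa′) (supportedAt-φ a′))

  offDiagonal-*≈0 : ∀ {m} {R S : Mat F m m} → OffDiagonal≈0 R → OffDiagonal≈0 S →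
    ∀ {i j i′ j′} → (i , j) ≢ (i′ , j′) → R i i′ * S j j′ ≈ 0#
  offDiagonal-*≈0 {R = R} {S} R-off S-off {i} {j} {i′} {j′} ij≢i′j′ with i ≟ i′ | j ≟ j′
  ... | no  i≢i′ | _        = trans (*-congʳ (R-off i i′ i≢i′)) (zeroˡ (S j j′))
  ... | yes _    | no  j≢j′ = trans (*-congˡ (S-off j j′ j≢j′)) (zeroʳ (R i i′))
  ... | yes refl | yes refl = contradiction ≡.refl ij≢i′j′

  inAut⇒offDiagonal≈0 : ∀ {n ℓ} {e : Edges n ℓ} {R S T} → Injective _≡_ _≡_ e → InAut F (arrayOf F e) R S T →
    OffDiagonal≈0 R → OffDiagonal≈0 S → (∀ x → R x x ≉ 0#) → (∀ y → S y y ≉ 0#) → OffDiagonal≈0 T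
  inAut⇒offDiagonal≈0 {e = e} {R} {S} {T} e-injective (_ , _ , _ , fixes) R-off S-off R-diag≉0 S-diag≉0 k k′ k≢k′ =
    x*y≈0⇒x≈0 (begin
      T k k′ * (R a a * S b b)                                       ≈⟨ sum-single k′ others ⟨
      sum (λ k″ → T k k″ * (R a (proj₁ (e k″)) * S b (proj₂ (e k″)))) ≈⟨ act-arrayOf e R S T a b k ⟨
      act F R S T (arrayOf F e) a b k                                ≈⟨ fixes a b k ⟩
      arrayOf F e a b k                                              ≈⟨ arrayOf-≢ e (k≢k′ ∘ e-injective) ⟩
      0#                                                             ∎)
    (x*y≉0 (R-diag≉0 a) (S-diag≉0 b))
    where
    a b : Fin _
    a = proj₁ (e k′)
    b = proj₂ (e k′)
    others : ∀ k″ → k″ ≢ k′ → T k k″ * (R a (proj₁ (e k″)) * S b (proj₂ (e k″))) ≈ 0#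
    others k″ k″≢k′ =
      trans (*-congˡ (offDiagonal-*≈0 R-off S-off (k″≢k′ ∘ e-injective ∘ ≡.sym))) (zeroʳ (T k k″))

  module _ {n ℓ} {e : Edges n ℓ} (e-injective : Injective _≡_ _≡_ e) {d}
           (regularL : ∀ x → degL e x ≡ d) (regularR : ∀ y → degR e y ≡ d) (asymmetric : Asymmetric e)
           {R S T} (inAut : InAut F (arrayOf F e) R S T) where

    private
      R-invertible : Invertible F R
      R-invertible = proj₁ inAut
      S-invertible : Invertible F S
      S-invertible = proj₁ (proj₂ inAut)
      respects : RespectsNonEdges e R S
      respects = inAut⇒respectsNonEdges inAut
      twinFree : TwinFree e
      twinFree = asymmetric⇒twinFree asymmetric
      swapped-twinFree : TwinFree (swapEdges e)
      swapped-twinFree = asymmetric⇒twinFree (asymmetric-swap asymmetric)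
      swapped-regular : ∀ y → degL (swapEdges e) y ≡ d
      swapped-regular y =
        ≡.trans (degL≡∣edgesAt∣ (swapEdges e) y) (≡.trans (≡.sym (degR≡∣edgesAt∣ e y)) (regularR y))

    diagonal≉0 : (∀ x → R x x ≉ 0#) × (∀ y → S y y ≉ 0#)
    diagonal≉0 =
      (λ x Rxx≈0 → ¬¬-decidable₂ λ R≈0? → ¬¬-decidable₂ λ S≈0? →
         proj₁ (withZeroTests R≈0? S≈0?) x Rxx≈0) ,
      (λ y Syy≈0 → ¬¬-decidable₂ λ R≈0? → ¬¬-decidable₂ λ S≈0? →
         proj₂ (withZeroTests R≈0? S≈0?) y Syy≈0)
      where
      withZeroTests : (∀ x a → Dec (R x a ≈ 0#)) → (∀ y b → Dec (S y b ≈ 0#)) →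
                      (∀ x → R x x ≉ 0#) × (∀ y → S y y ≉ 0#)
      withZeroTests R≈0? S≈0? =
        (λ x → ≡.subst (λ z → R z x ≉ 0#) (proj₁ fixed x) (Rows.R[φa,a]≉0 x)) ,
        (λ y → ≡.subst (λ z → S z y ≉ 0#) (proj₂ fixed y) (Cols.R[φa,a]≉0 y))
        where
        module Rows = Monomial e-injective regularL twinFree
          R-invertible S-invertible respects R≈0? S≈0?
        module Cols = Monomial (swapEdges-injective e-injective) swapped-regular swapped-twinFree
          S-invertible R-invertible (respectsNonEdges⇒swap respects) S≈0? R≈0?
        σ τ : Permutation′ n
        σ = proj₁ (injective⇒permutation Rows.φ-injective)
        τ = proj₁ (injective⇒permutation Cols.φ-injective)
        preserve : ∀ i j → HasEdge e i j → HasEdge e (σ ⟨$⟩ʳ i) (τ ⟨$⟩ʳ j)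
        preserve i j i∼j with hasEdge? e (σ ⟨$⟩ʳ i) (τ ⟨$⟩ʳ j)
        ... | yes σi∼τj = σi∼τj
        ... | no  σi≁τj =
          contradiction (respects i∼j σi≁τj) (x*y≉0 (Rows.R[φa,a]≉0 i) (Cols.R[φa,a]≉0 j))
        fixed : (∀ i → σ ⟨$⟩ʳ i ≡ i) × (∀ j → τ ⟨$⟩ʳ j ≡ j)
        fixed = asymmetric σ τ (edgePreserving⇒IsGraphAut e-injective σ τ preserve)

    inAut⇒diagonal : IsDiagonal F R × IsDiagonal F S × IsDiagonal F T
    inAut⇒diagonal =
      (R-invertible , R-off) , (S-invertible , S-off) ,
      (proj₁ (proj₂ (proj₂ inAut)) ,
       inAut⇒offDiagonal≈0 e-injective inAut R-off S-off R-diagonal≉0 S-diagonal≉0)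
      where
      R-diagonal≉0 : ∀ x → R x x ≉ 0#
      R-diagonal≉0 = proj₁ diagonal≉0
      S-diagonal≉0 : ∀ y → S y y ≉ 0#
      S-diagonal≉0 = proj₂ diagonal≉0
      R-off : OffDiagonal≈0 R
      R-off = respectsNonEdges⇒offDiagonal≈0 e-injective regularL twinFree respects S-diagonal≉0
      S-off : OffDiagonal≈0 S
      S-off = respectsNonEdges⇒offDiagonal≈0 (swapEdges-injective e-injective) swapped-regular swapped-twinFree
        (respectsNonEdges⇒swap respects) R-diagonal≉0

  arrayOf≈δ*δ : ∀ {n ℓ} (e : Edges n ℓ) i j k →
    arrayOf F e i j k ≈ I F i (proj₁ (e k)) * I F j (proj₂ (e k))
  arrayOf≈δ*δ e i j k with ≡-dec _≟_ _≟_ (e k) (i , j)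
  ... | yes ek≡ij with ai≡ , bj≡ ← ×-≡,≡←≡ ek≡ij =
    sym (trans (*-cong (I-≡ (≡.sym ai≡)) (I-≡ (≡.sym bj≡))) (*-identityˡ 1#))
  ... | no  ek≢ij = sym (offDiagonal-*≈0 (λ _ _ → I-≢) (λ _ _ → I-≢) (ek≢ij ∘ ≡.sym))

  permMatrix : ∀ {m} → (Fin m → Fin m) → Mat F m m
  permMatrix f i j = I F i (f j)

  sum-permMatrix : ∀ {m} (π : Permutation′ m) (f : Fin m → Carrier) k →
    sum (λ k′ → permMatrix (π ⟨$⟩ʳ_) k k′ * f k′) ≈ f (π ⟨$⟩ˡ k)
  sum-permMatrix π f k = begin
    sum (λ k′ → I F k (π ⟨$⟩ʳ k′) * f k′)
      ≈⟨ sum-single (π ⟨$⟩ˡ k) (λ k′ k′≢ → trans (*-congʳ (I-≢ (k′≢ ∘ moved))) (zeroˡ (f k′))) ⟩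
    I F k (π ⟨$⟩ʳ (π ⟨$⟩ˡ k)) * f (π ⟨$⟩ˡ k)
      ≈⟨ *-congʳ (I-≡ {i = k} (≡.sym (Perm.inverseʳ π))) ⟩
    1# * f (π ⟨$⟩ˡ k)
      ≈⟨ *-identityˡ _ ⟩
    f (π ⟨$⟩ˡ k)
      ∎
    where
    moved : ∀ {k′} → k ≡ π ⟨$⟩ʳ k′ → k′ ≡ π ⟨$⟩ˡ k
    moved k≡ = ≡.trans (≡.sym (Perm.inverseˡ π)) (≡.cong (π ⟨$⟩ˡ_) (≡.sym k≡))

  I-injective : ∀ {m} {f : Fin m → Fin m} → Injective _≡_ _≡_ f → ∀ i j → I F (f i) (f j) ≈ I F i j
  I-injective {f = f} f-injective i j with i ≟ j
  ... | yes refl = I-refl (f i)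
  ... | no  i≢j  = I-≢ (i≢j ∘ f-injective)

  permMatrix-invertible : ∀ {m} (π : Permutation′ m) → Invertible F (permMatrix (π ⟨$⟩ʳ_))
  permMatrix-invertible π =
    permMatrix (π ⟨$⟩ˡ_) ,
    (λ i j → trans (sum-permMatrix π (λ r → I F r (π ⟨$⟩ˡ j)) i)
                   (I-injective (⟨$⟩ʳ-injective (Perm.flip π)) i j)) ,
    (λ i j → trans (sum-permMatrix (Perm.flip π) (λ r → I F r (π ⟨$⟩ʳ j)) i)
                   (I-injective (⟨$⟩ʳ-injective π) i j))

  permMatrix-offDiagonal≈0⇒id : ∀ {m} {f : Fin m → Fin m} →
    OffDiagonal≈0 (permMatrix f) → ∀ i → f i ≡ i
  permMatrix-offDiagonal≈0⇒id {f = f} off i with f i ≟ i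
  ... | yes fi≡i = fi≡i
  ... | no  fi≢i = ⊥-elim (1≉0 (trans (sym (I-refl (f i))) (off (f i) i fi≢i)))

  permMatrices-inAut : ∀ {n ℓ} {e : Edges n ℓ} (σ τ : Permutation′ n) (π : Permutation′ ℓ) →
    (∀ k → e (π ⟨$⟩ʳ k) ≡ map (σ ⟨$⟩ʳ_) (τ ⟨$⟩ʳ_) (e k)) →
    InAut F (arrayOf F e) (permMatrix (σ ⟨$⟩ʳ_)) (permMatrix (τ ⟨$⟩ʳ_)) (permMatrix (π ⟨$⟩ʳ_))
  permMatrices-inAut {e = e} σ τ π eπ≡ =
    permMatrix-invertible σ , permMatrix-invertible τ , permMatrix-invertible π , fixes
    where
    Pσ Pτ : Mat F _ _
    Pσ = permMatrix (σ ⟨$⟩ʳ_)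
    Pτ = permMatrix (τ ⟨$⟩ʳ_)
    Pπ : Mat F _ _
    Pπ = permMatrix (π ⟨$⟩ʳ_)
    fixes : ∀ i j k → act F Pσ Pτ Pπ (arrayOf F e) i j k ≈ arrayOf F e i j k
    fixes i j k = begin
      act F Pσ Pτ Pπ (arrayOf F e) i j k
        ≈⟨ act-arrayOf e Pσ Pτ Pπ i j k ⟩
      sum (λ k′ → Pπ k k′ * (Pσ i (proj₁ (e k′)) * Pτ j (proj₂ (e k′))))
        ≈⟨ sum-permMatrix π _ k ⟩
      I F i (σ ⟨$⟩ʳ proj₁ (e k″)) * I F j (τ ⟨$⟩ʳ proj₂ (e k″))
        ≡⟨ ≡.cong (λ p → I F i (proj₁ p) * I F j (proj₂ p)) ek≡ ⟨
      I F i (proj₁ (e k)) * I F j (proj₂ (e k))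
        ≈⟨ arrayOf≈δ*δ e i j k ⟨
      arrayOf F e i j k
        ∎
      where
      k″ : Fin _
      k″ = π ⟨$⟩ˡ k
      ek≡ : e k ≡ map (σ ⟨$⟩ʳ_) (τ ⟨$⟩ʳ_) (e k″)
      ek≡ = ≡.trans (≡.cong e (≡.sym (Perm.inverseʳ π))) (eπ≡ k″)

  autDiagonal⇒asymmetric : ∀ {n ℓ} {e : Edges n ℓ} → Injective _≡_ _≡_ e → AutDiagonal F e → Asymmetric e
  autDiagonal⇒asymmetric {e = e} e-injective autDiagonal σ τ aut =
    permMatrix-offDiagonal≈0⇒id (proj₂ (proj₁ diagonal)) ,
    permMatrix-offDiagonal≈0⇒id (proj₂ (proj₁ (proj₂ diagonal)))
    where
    π : Σ (Permutation′ _) λ π → ∀ k → e (π ⟨$⟩ʳ k) ≡ map (σ ⟨$⟩ʳ_) (τ ⟨$⟩ʳ_) (e k)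
    π = edgePermutation e-injective σ τ (λ k → Equivalence.to (aut _ _) (k , ≡.refl))
    diagonal : IsDiagonal F (permMatrix (σ ⟨$⟩ʳ_)) × IsDiagonal F (permMatrix (τ ⟨$⟩ʳ_)) ×
               IsDiagonal F (permMatrix (proj₁ π ⟨$⟩ʳ_))
    diagonal = autDiagonal _ _ _ (permMatrices-inAut σ τ (proj₁ π) (proj₂ π))

  diag : ∀ {m} → (Fin m → Carrier) → Mat F m m
  diag t i j = t i * I F i j

  diag-sum : ∀ {m} (t g : Fin m → Carrier) i → sum (λ j → diag t i j * g j) ≈ t i * g i
  diag-sum t g i = begin
    sum (λ j → t i * I F i j * g j)    ≈⟨ sum-cong-≋ (λ j → *-assoc (t i) (I F i j) (g j)) ⟩
    sum (λ j → t i * (I F i j * g j))  ≈⟨ *-distribˡ-sum (t i) (λ j → I F i j * g j) ⟨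
    t i * sum (λ j → I F i j * g j)    ≈⟨ *-congˡ (δ-sum i g) ⟩
    t i * g i                          ∎

  diag-invertible : ∀ {m} {t u : Fin m → Carrier} → (∀ i → t i * u i ≈ 1#) → Invertible F (diag t)
  diag-invertible {t = t} {u} tu≈1 =
    diag u , diag⊗diag tu≈1 , diag⊗diag (λ i → trans (*-comm (u i) (t i)) (tu≈1 i))
    where
    diag⊗diag : ∀ {t u} → (∀ i → t i * u i ≈ 1#) → _≈M_ F (_⊗_ F (diag t) (diag u)) (I F)
    diag⊗diag {t} {u} tu≈1 i j = begin
      sum (λ r → diag t i r * diag u r j) ≈⟨ diag-sum t (λ r → diag u r j) i ⟩
      t i * (u i * I F i j)               ≈⟨ *-assoc (t i) (u i) (I F i j) ⟨
      t i * u i * I F i j                 ≈⟨ *-congʳ (tu≈1 i) ⟩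
      1# * I F i j                        ≈⟨ *-identityˡ (I F i j) ⟩
      I F i j                             ∎

  isDiagonal⇒diagonal≉0 : ∀ {m} {D : Mat F m m} → IsDiagonal F D → ∀ i → D i i ≉ 0#
  isDiagonal⇒diagonal≉0 {D = D} (D-invertible , D-off) i Dii≈0 =
    invertible⇒column≉0 D-invertible i column≈0
    where
    column≈0 : ∀ x → D x i ≈ 0#
    column≈0 x with x ≟ i
    ... | yes refl = Dii≈0
    ... | no  x≢i  = D-off x i x≢i

  isDiagonal⇒inAut : ∀ {n ℓ} (e : Edges n ℓ) {D : Mat F n n} → IsDiagonal F D →
    ∃[ S ] ∃[ T ] InAut F (arrayOf F e) D S T
  isDiagonal⇒inAut {ℓ = ℓ} e {D} D-diagonal@(D-invertible , D-off) =
    I F , diag t , D-invertible , permMatrix-invertible Perm.id , diag-invertible td≈1 , fixes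
    where
    a b : Fin ℓ → _
    a = proj₁ ∘ e
    b = proj₂ ∘ e
    d⁻¹ : ∀ k → ∃ λ y → D (a k) (a k) * y ≈ 1#
    d⁻¹ k = inverse (D (a k) (a k)) (isDiagonal⇒diagonal≉0 D-diagonal (a k))
    t : Fin ℓ → Carrier
    t k = proj₁ (d⁻¹ k)
    td≈1 : ∀ k → t k * D (a k) (a k) ≈ 1#
    td≈1 k = trans (*-comm (t k) _) (proj₂ (d⁻¹ k))
    edgeValue : ∀ i j k → t k * (D i (a k) * I F j (b k)) ≈ arrayOf F e i j k
    edgeValue i j k with ≡-dec _≟_ _≟_ (e k) (i , j)
    ... | no  ek≢ij =
      trans (*-congˡ (offDiagonal-*≈0 D-off (λ _ _ → I-≢) (ek≢ij ∘ ≡.sym))) (zeroʳ (t k))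
    ... | yes ek≡ij with refl , refl ← ×-≡,≡←≡ ek≡ij = begin
      t k * (D (a k) (a k) * I F (b k) (b k)) ≈⟨ *-congˡ (trans (*-congˡ (I-refl (b k))) (*-identityʳ _)) ⟩
      t k * D (a k) (a k)                     ≈⟨ td≈1 k ⟩
      1#                                      ∎
    fixes : ∀ i j k → act F D (I F) (diag t) (arrayOf F e) i j k ≈ arrayOf F e i j k
    fixes i j k = begin
      act F D (I F) (diag t) (arrayOf F e) i j k
        ≈⟨ act-arrayOf e D (I F) (diag t) i j k ⟩
      sum (λ k′ → diag t k k′ * (D i (a k′) * I F j (b k′)))
        ≈⟨ diag-sum t (λ k′ → D i (a k′) * I F j (b k′)) k ⟩
      t k * (D i (a k) * I F j (b k))
        ≈⟨ edgeValue i j k ⟩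
      arrayOf F e i j k
        ∎

-- The second part holds for every graph, asymmetric or not.
lemma4p9 : ∀ {c ℓ′ : Level} (F : Field c ℓ′) (n ℓ : ℕ) (e : Edges n ℓ) →
    Injective _≡_ _≡_ e → Regular e →
    (Asymmetric e ⇔ AutDiagonal F e) ×
    (Asymmetric e → ∀ (D : Mat F n n) → IsDiagonal F D →
      ∃[ S ] ∃[ T ] InAut F (arrayOf F e) D S T)
lemma4p9 F n ℓ e e-injective (d , regularL , regularR) =
  mk⇔ (λ asymmetric _ _ _ → inAut⇒diagonal F e-injective regularL regularR asymmetric)
      (autDiagonal⇒asymmetric F e-injective) ,
  λ _ _ → isDiagonal⇒inAut F e
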